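{- For every integer $n\ge 4$, $fw(1\,2\ldots n\;1\;2\;4\ldots n\;3\;2)=4$.
   Context: Sequences are written as concatenations of letters. A sequence $s$ contains $u$ if some (not necessarily contiguous) subsequence of $s$ can be changed into $u$ by a one-to-one renaming of letters. An $(r,s)$-formation is a concatenation of $s$ permutations, each of the same set of $r$ distinct letters. The formation width $fw(u)$ is the minimum $s$ such that there exists $r$ for which every $(r,s)$-formation contains $u$. -}

module Defs where

open import Data.Nat using (ℕ; suc; _+_; _∸_; _<_)
open import Data.List using (List; []; _∷_; _++_; map; length; concat; upTo)
open import Data.List.Relation.Binary.Sublist.Propositional using (_⊆_)
open import Data.List.Relation.Binary.Permutation.Propositional using (_↭_)
open import Data.List.Relation.Unary.All using (All)
open import Data.List.Relation.Unary.Unique.Propositional using (Unique)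
open import Data.List.Membership.Propositional using (_∈_)
open import Data.Product using (Σ; ∃; _×_)
open import Relation.Binary.PropositionalEquality using (_≡_)
open import Relation.Nullary using (¬_)

Seq : Set
Seq = List ℕ

Contains : Seq → Seq → Set
Contains s u =
  Σ Seq λ sub → sub ⊆ s ×
    Σ (ℕ → ℕ) λ f →
      (∀ {x y} → x ∈ sub → y ∈ sub → f x ≡ f y → x ≡ y) ×
      map f sub ≡ u

IsFormation : ℕ → ℕ → Seq → Set
IsFormation r s w =
  Σ Seq λ L → length L ≡ r × Unique L ×
    Σ (List Seq) λ ps → length ps ≡ s × All (λ p → p ↭ L) ps ×
      w ≡ concat ps

Forces : ℕ → Seq → Set
Forces s u = ∃ λ r → ∀ w → IsFormation r s w → Contains w u

FormationWidth : Seq → ℕ → Set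
FormationWidth u k = Forces k u × (∀ s → s < k → ¬ Forces s u)

-- The sequence 1 2 … n 1 2 4 … n 3 2.
pattern12 : ℕ → Seq
pattern12 n =
  map suc (upTo n) ++ (1 ∷ 2 ∷ []) ++ map (λ i → i + 4) (upTo (n ∸ 3)) ++ (3 ∷ 2 ∷ [])

-- Upper bound: take an (r,4)-formation q₁ q₂ q₃ q₄ with r huge. Applying Erdős–Szekeres three
-- times yields n letters ys, listed in their q₁ order, which every later block qᵢ lists either in
-- the same or in the reverse order. In each of the eight direction patterns the four blocks
-- contain, piece by piece, a word a b c D a b D c b with D the other n − 3 letters, and
-- relabelling a, b, c, D as 1, 2, 3, 4 … n turns it into 1 2 … n 1 2 4 … n 3 2.
-- Lower bound: the pattern contains a b a b b, which does not occur in the (r,3)-formation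
-- (0 … r−1)(r−1 … 0)(0 … r−1) nor in its prefixes, because each of the three monotone blocks can
-- contribute each letter at most once.
module Submission where

open import Defs

open import Data.Bool.Base using (true; false)
open import Data.Empty using (⊥)
open import Data.Nat.Base using (ℕ; zero; suc; _+_; _≤_; _<_; _>_; s≤s)
open import Data.Nat.Properties
  using (_≟_; _≤?_; suc-injective; +-comm; +-suc; +-cancelˡ-≤; +-monoˡ-≤; ≤-trans; ≤-reflexive;
         <⇒≤; ≰⇒>; <-irrefl; <-asym; m≤m+n; m≤n⇒∃[o]m+o≡n)
open import Data.List.Base
  using (List; []; _∷_; _++_; concat; map; length; reverse; filter; take; drop; upTo; downFrom; applyUpTo)
open import Data.List.Properties
  using (++-assoc; ++-identityʳ; map-++; map-∘; map-cong; map-cong-local; map-upTo; map-applyUpTo;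
         length-upTo; length-reverse; unfold-reverse; ʳ++-defn; reverse-involutive; reverse-upTo)
open import Data.List.Membership.Propositional using (_∈_)
open import Data.List.Membership.Propositional.Properties using (∈-∃++; ∈-++⁻; ∈-filter⁻)
open import Data.List.Membership.DecPropositional _≟_ using (_∈?_)
open import Data.List.Relation.Binary.Sublist.Propositional
  using (_⊆_; []; _∷_; _∷ʳ_; ⊆-refl; ⊆-trans; ⊆-reflexive; minimum; lookup)
open import Data.List.Relation.Binary.Sublist.Propositional.Properties
  using (++⁺; ++⁺ˡ; ++⁺ʳ; reverse⁺; filter-⊆; All-resp-⊆)
open import Data.List.Relation.Binary.Permutation.Propositional
  using (_↭_; ↭-refl; ↭-sym; ↭-trans; prep; swap; ↭⇒↭ₛ)
open import Data.List.Relation.Binary.Permutation.Propositional.Properties using (↭-reverse; ↭-length; ∈-resp-↭)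
open import Data.List.Relation.Unary.All as All using (All; []; _∷_)
open import Data.List.Relation.Unary.All.Properties using (all-filter) renaming (++⁺ to All-++⁺)
open import Data.List.Relation.Unary.AllPairs using (AllPairs; []; _∷_)
open import Data.List.Relation.Unary.AllPairs.Properties using (applyUpTo⁺₁; applyDownFrom⁺₁)
open import Data.List.Relation.Unary.Any using (here; there)
open import Data.List.Relation.Unary.Unique.Propositional using (Unique)
open import Data.List.Relation.Unary.Unique.Propositional.Properties using (filter⁺; upTo⁺)
open import Data.Product.Base using (∃-syntax; ∃₂; _×_; _,_)
open import Data.Sum.Base as Sum using (_⊎_; inj₁; inj₂)
open import Function.Base using (_∘_; id; case_of_)
open import Relation.Binary.PropositionalEquality
  using (_≡_; _≢_; refl; sym; trans; cong; cong₂; subst; setoid; module ≡-Reasoning)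
open import Data.List.Relation.Binary.Permutation.Setoid.Properties (setoid ℕ)
  using () renaming (Unique-resp-↭ to Unique-resp-↭ₛ)
open import Relation.Nullary.Decidable.Core using (does; yes; no)
open import Relation.Nullary.Negation using (¬_; contradiction)
open import Relation.Unary using (Pred; Decidable)
open import Relation.Unary.Properties using (∁?)

length-filter-∁ : ∀ {a p} {A : Set a} {P : Pred A p} (P? : Decidable P) xs →
                  length (filter P? xs) + length (filter (∁? P?) xs) ≡ length xs
length-filter-∁ P? []       = refl
length-filter-∁ P? (x ∷ xs) with does (P? x)
... | true  = cong suc (length-filter-∁ P? xs)
... | false = trans (+-suc _ _) (cong suc (length-filter-∁ P? xs))

AllPairs-resp-⊇ : ∀ {a r} {A : Set a} {R : A → A → Set r} {xs ys} → xs ⊆ ys → AllPairs R ys → AllPairs R xs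
AllPairs-resp-⊇ []           []         = []
AllPairs-resp-⊇ (_ ∷ʳ xs⊆)   (_ ∷ rys)  = AllPairs-resp-⊇ xs⊆ rys
AllPairs-resp-⊇ (refl ∷ xs⊆) (ry ∷ rys) = All-resp-⊆ xs⊆ ry ∷ AllPairs-resp-⊇ xs⊆ rys

AllPairs-repeat : ∀ {r} {R : ℕ → ℕ → Set r} {x ys} → AllPairs R (x ∷ ys) → x ∈ ys → R x x
AllPairs-repeat (Rx ∷ _) x∈ys = All.lookup Rx x∈ys

Unique-resp-↭ : ∀ {xs ys : List ℕ} → xs ↭ ys → Unique xs → Unique ys
Unique-resp-↭ = Unique-resp-↭ₛ ∘ ↭⇒↭ₛ

Unique-reverse : ∀ {xs : List ℕ} → Unique xs → Unique (reverse xs)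
Unique-reverse {xs} = Unique-resp-↭ (↭-sym (↭-reverse xs))

All-∈-↭ : ∀ {xs ys zs : List ℕ} → xs ↭ zs → ys ↭ zs → All (_∈ ys) xs
All-∈-↭ xs↭zs ys↭zs = All.tabulate (∈-resp-↭ (↭-trans xs↭zs (↭-sym ys↭zs)))

⊆-++⁻ : ∀ (ys : List ℕ) {xs zs} → xs ⊆ ys ++ zs → ∃[ k ] take k xs ⊆ ys × drop k xs ⊆ zs
⊆-++⁻ []       xs⊆          = 0 , [] , xs⊆
⊆-++⁻ (y ∷ ys) (_ ∷ʳ xs⊆)   = let k , t , d = ⊆-++⁻ ys xs⊆ in k , y ∷ʳ t , d
⊆-++⁻ (y ∷ ys) (refl ∷ xs⊆) = let k , t , d = ⊆-++⁻ ys xs⊆ in suc k , refl ∷ t , d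

⊆-map⁻ : ∀ (f : ℕ → ℕ) {v} xs → v ⊆ map f xs → ∃[ xs′ ] xs′ ⊆ xs × map f xs′ ≡ v
⊆-map⁻ f []       []          = [] , [] , refl
⊆-map⁻ f (x ∷ xs) (_ ∷ʳ v⊆)   = let xs′ , xs′⊆ , eq = ⊆-map⁻ f xs v⊆ in xs′ , x ∷ʳ xs′⊆ , eq
⊆-map⁻ f (x ∷ xs) (refl ∷ v⊆) = let xs′ , xs′⊆ , eq = ⊆-map⁻ f xs v⊆ in x ∷ xs′ , refl ∷ xs′⊆ , cong (f x ∷_) eq

-- Erdős–Szekeres

esBound : ℕ → ℕ → ℕ
esBound zero    _       = 0
esBound (suc a) zero    = 0
esBound (suc a) (suc b) = suc (esBound a (suc b) + esBound (suc a) b)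

All-∈-pre : ∀ {x : ℕ} {xs} pre post → All (x ≢_) xs → All (_∈ pre ++ x ∷ post) xs →
            All (_∈ pre) (filter (∁? (_∈? post)) xs)
All-∈-pre pre post x∉xs xs∈q = All.tabulate λ y∈ →
  let y∈xs , y∉post = ∈-filter⁻ (∁? (_∈? post)) y∈ in
  case ∈-++⁻ pre (All.lookup xs∈q y∈xs) of λ where
    (inj₁ y∈pre)          → y∈pre
    (inj₂ (here y≡x))     → contradiction (sym y≡x) (All.lookup x∉xs y∈xs)
    (inj₂ (there y∈post)) → contradiction y∈post y∉post

-- Split q at the head x of ys; the rest of ys falls into the letters after x in q and those
-- before it, and one of the two parts is long enough to recurse on.
erdős-szekeres : ∀ a b {q} (ys : List ℕ) → Unique ys → All (_∈ q) ys → esBound a b ≤ length ys →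
  ∃[ zs ] zs ⊆ ys × (length zs ≡ a × zs ⊆ q ⊎ length zs ≡ b × reverse zs ⊆ q)
erdős-szekeres zero    b       ys _ _ _ = [] , minimum ys , inj₁ (refl , minimum _)
erdős-szekeres (suc a) zero    ys _ _ _ = [] , minimum ys , inj₂ (refl , minimum _)
erdős-szekeres (suc a) (suc b) (x ∷ xs) (x∉xs ∷ u) (x∈q ∷ xs∈q) (s≤s bound) with ∈-∃++ x∈q
... | pre , post , refl with esBound a (suc b) ≤? length (filter (_∈? post) xs)
... | yes enough with erdős-szekeres a (suc b) _ (filter⁺ _ u) (all-filter _ xs) enough
...   | zs , zs⊆ , inj₁ (len , zs⊆post) =
  x ∷ zs , refl ∷ ⊆-trans zs⊆ (filter-⊆ _ xs) , inj₁ (cong suc len , ++⁺ˡ pre (refl ∷ zs⊆post))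
...   | zs , zs⊆ , inj₂ (len , zs⊆post) =
  zs , x ∷ʳ ⊆-trans zs⊆ (filter-⊆ _ xs) , inj₂ (len , ++⁺ˡ pre (x ∷ʳ zs⊆post))
erdős-szekeres (suc a) (suc b) (x ∷ xs) (x∉xs ∷ u) (x∈q ∷ xs∈q) (s≤s bound) | pre , post , refl | no short
  with erdős-szekeres (suc a) b _ (filter⁺ _ u) (All-∈-pre pre post x∉xs xs∈q)
         (+-cancelˡ-≤ (esBound a (suc b)) _ _ (≤-trans bound (≤-trans
           (≤-reflexive (sym (length-filter-∁ (_∈? post) xs))) (+-monoˡ-≤ _ (<⇒≤ (≰⇒> short))))))
...   | zs , zs⊆ , inj₁ (len , zs⊆pre) =
  zs , x ∷ʳ ⊆-trans zs⊆ (filter-⊆ _ xs) , inj₁ (len , ++⁺ʳ _ zs⊆pre)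
...   | zs , zs⊆ , inj₂ (len , zs⊆pre) =
  x ∷ zs , refl ∷ ⊆-trans zs⊆ (filter-⊆ _ xs) ,
  inj₂ (cong suc len , subst (_⊆ _) (sym (unfold-reverse x zs)) (++⁺ zs⊆pre (refl ∷ minimum post)))

Monotone : List ℕ → List ℕ → Set
Monotone q ys = ys ⊆ q ⊎ reverse ys ⊆ q

Monotone-resp-⊇ : ∀ {q xs ys} → xs ⊆ ys → Monotone q ys → Monotone q xs
Monotone-resp-⊇ xs⊆ = Sum.map (⊆-trans xs⊆) (⊆-trans (reverse⁺ xs⊆))

reverse²-⊆ : ∀ {q} (ys : List ℕ) → ys ⊆ q → reverse (reverse ys) ⊆ q
reverse²-⊆ ys = subst (_⊆ _) (sym (reverse-involutive ys))

Monotone-reverse : ∀ {q} ys → Monotone q ys → Monotone q (reverse ys)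
Monotone-reverse ys = Sum.[ inj₂ ∘ reverse²-⊆ ys , inj₁ ]′

monotone-sublist : ∀ n {q} (ys : List ℕ) → Unique ys → All (_∈ q) ys → esBound n n ≤ length ys →
  ∃[ zs ] zs ⊆ ys × length zs ≡ n × Monotone q zs
monotone-sublist n ys u ys∈q bound with erdős-szekeres n n ys u ys∈q bound
... | zs , zs⊆ys , inj₁ (len , zs⊆q) = zs , zs⊆ys , len , inj₁ zs⊆q
... | zs , zs⊆ys , inj₂ (len , zs⊆q) = zs , zs⊆ys , len , inj₂ zs⊆q

esTower : ℕ → ℕ → ℕ
esTower zero    n = n
esTower (suc k) n = esBound (esTower k n) (esTower k n)

monotone-sublist-all : ∀ n qs (ys : List ℕ) → Unique ys → All (λ q → All (_∈ q) ys) qs →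
  length ys ≡ esTower (length qs) n → ∃[ zs ] zs ⊆ ys × length zs ≡ n × All (λ q → Monotone q zs) qs
monotone-sublist-all n []       ys _ _              len = ys , ⊆-refl , len , []
monotone-sublist-all n (q ∷ qs) ys u (ys∈q ∷ ys∈qs) len
  with zs , zs⊆ys , len′ , mono ← monotone-sublist _ ys u ys∈q (≤-reflexive (sym len))
  with ws , ws⊆zs , len″ , monos ← monotone-sublist-all n qs zs (AllPairs-resp-⊇ zs⊆ys u)
                                     (All.map (All-resp-⊆ zs⊆ys) ys∈qs) len′
  = ws , ⊆-trans ws⊆zs zs⊆ys , len″ , Monotone-resp-⊇ ws⊆zs mono ∷ monos

-- Relabelling into the pattern

position : List ℕ → ℕ → ℕ
position []       x = 0
position (y ∷ ys) x with y ≟ x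
... | yes _ = 0
... | no  _ = suc (position ys x)

position-here : ∀ x ys → position (x ∷ ys) x ≡ 0
position-here x ys with x ≟ x
... | yes _   = refl
... | no  x≢x = contradiction refl x≢x

position-there : ∀ {x y} ys → y ≢ x → position (y ∷ ys) x ≡ suc (position ys x)
position-there {x} {y} ys y≢x with y ≟ x
... | yes y≡x = contradiction y≡x y≢x
... | no  _   = refl

position-++ : ∀ {x} ys zs → All (_≢ x) ys → position (ys ++ zs) x ≡ length ys + position zs x
position-++ []       zs []           = refl
position-++ (y ∷ ys) zs (y≢x ∷ ys≢x) = trans (position-there (ys ++ zs) y≢x) (cong suc (position-++ ys zs ys≢x))

position-injective : ∀ {xs x y} → x ∈ xs → y ∈ xs → position xs x ≡ position xs y → x ≡ y
position-injective {z ∷ zs} {x} {y} x∈ y∈ eq with z ≟ x | z ≟ y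
... | yes refl | yes refl = refl
... | no z≢x   | no z≢y with x∈ | y∈
...   | here x≡z  | _         = contradiction (sym x≡z) z≢x
...   | there _   | here y≡z  = contradiction (sym y≡z) z≢y
...   | there x∈′ | there y∈′ = position-injective x∈′ y∈′ (suc-injective eq)

map-position : ∀ xs → Unique xs → map (position xs) xs ≡ upTo (length xs)
map-position []       []         = refl
map-position (x ∷ xs) (x∉xs ∷ u) = cong₂ _∷_ (position-here x xs) (begin
  map (position (x ∷ xs)) xs     ≡⟨ map-cong-local (All.map (position-there xs) x∉xs) ⟩
  map (suc ∘ position xs) xs     ≡⟨ map-∘ xs ⟩
  map suc (map (position xs) xs) ≡⟨ cong (map suc) (map-position xs u) ⟩
  map suc (upTo (length xs))     ≡⟨ map-upTo suc (length xs) ⟩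
  applyUpTo suc (length xs)      ∎)
  where open ≡-Reasoning

-- The word a b c D a b D c b; with a, b, c, D renamed 1, 2, 3, 4 … n it is pattern12 n.
shape : ℕ → ℕ → ℕ → List ℕ → List ℕ
shape a b c ds = a ∷ b ∷ c ∷ ds ++ a ∷ b ∷ ds ++ c ∷ b ∷ []

shape-cong : ∀ {a a′ b b′ c c′ ds ds′} → a ≡ a′ → b ≡ b′ → c ≡ c′ → ds ≡ ds′ → shape a b c ds ≡ shape a′ b′ c′ ds′
shape-cong refl refl refl refl = refl

map-shape : ∀ (f : ℕ → ℕ) a b c ds → map f (shape a b c ds) ≡ shape (f a) (f b) (f c) (map f ds)
map-shape f a b c ds = cong (λ t → f a ∷ f b ∷ f c ∷ t) (begin
  map f (ds ++ a ∷ b ∷ ds ++ c ∷ b ∷ [])             ≡⟨ map-++ f ds _ ⟩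
  map f ds ++ f a ∷ f b ∷ map f (ds ++ c ∷ b ∷ [])   ≡⟨ cong (λ t → map f ds ++ f a ∷ f b ∷ t) (map-++ f ds _) ⟩
  map f ds ++ f a ∷ f b ∷ map f ds ++ f c ∷ f b ∷ [] ∎)
  where open ≡-Reasoning

pattern12-shape : ∀ k → pattern12 (3 + k) ≡ shape 1 2 3 (map (_+ 4) (upTo k))
pattern12-shape k = cong (λ t → 1 ∷ 2 ∷ 3 ∷ t ++ 1 ∷ 2 ∷ map (_+ 4) (upTo k) ++ 3 ∷ 2 ∷ []) (begin
  map suc (applyUpTo (3 +_) k) ≡⟨ map-applyUpTo (3 +_) suc k ⟩
  applyUpTo (4 +_) k           ≡⟨ map-upTo (4 +_) k ⟨
  map (4 +_) (upTo k)          ≡⟨ map-cong (+-comm 4) (upTo k) ⟩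
  map (_+ 4) (upTo k)          ∎)
  where open ≡-Reasoning

shape-letters : ∀ a b c ds → All (_∈ a ∷ b ∷ c ∷ ds) (shape a b c ds)
shape-letters a b c ds = All-++⁺ (All.tabulate id) (here refl ∷ there (here refl) ∷
  All-++⁺ (All.tabulate (there ∘ there ∘ there)) (there (there (here refl)) ∷ there (here refl) ∷ []))

shape⊆⇒contains : ∀ {a b c ds w} → Unique (a ∷ b ∷ c ∷ ds) → shape a b c ds ⊆ w →
                  Contains w (pattern12 (3 + length ds))
shape⊆⇒contains {a} {b} {c} {ds} ((a≢b ∷ a≢c ∷ a∉ds) ∷ (b≢c ∷ b∉ds) ∷ c∉ds ∷ uds) shape⊆w =
  shape a b c ds , shape⊆w , label , injective , (begin
    map label (shape a b c ds)                         ≡⟨ map-shape label a b c ds ⟩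
    shape (label a) (label b) (label c) (map label ds) ≡⟨ shape-cong label-a label-b label-c label-ds ⟩
    shape 1 2 3 (map (_+ 4) (upTo (length ds)))        ≡⟨ pattern12-shape (length ds) ⟨
    pattern12 (3 + length ds)                          ∎)
  where
  open ≡-Reasoning
  label : ℕ → ℕ
  label = suc ∘ position (a ∷ b ∷ c ∷ ds)
  injective : ∀ {x y} → x ∈ shape a b c ds → y ∈ shape a b c ds → label x ≡ label y → x ≡ y
  injective x∈ y∈ eq = position-injective (All.lookup (shape-letters a b c ds) x∈)
    (All.lookup (shape-letters a b c ds) y∈) (suc-injective eq)
  label-a : label a ≡ 1
  label-a = cong suc (position-here a _)
  label-b : label b ≡ 2
  label-b = cong suc (trans (position-++ (a ∷ []) _ (a≢b ∷ [])) (cong suc (position-here b _)))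
  label-c : label c ≡ 3
  label-c = cong suc (trans (position-++ (a ∷ b ∷ []) _ (a≢c ∷ b≢c ∷ [])) (cong (2 +_) (position-here c _)))
  label-ds : map label ds ≡ map (_+ 4) (upTo (length ds))
  label-ds = begin
    map label ds                      ≡⟨ map-cong-local (All.tabulate λ d∈ → cong suc (position-++ (a ∷ b ∷ c ∷ []) ds
                                           (All.lookup a∉ds d∈ ∷ All.lookup b∉ds d∈ ∷ All.lookup c∉ds d∈ ∷ []))) ⟩
    map ((4 +_) ∘ position ds) ds     ≡⟨ map-∘ ds ⟩
    map (4 +_) (map (position ds) ds) ≡⟨ cong (map (4 +_)) (map-position ds uds) ⟩
    map (4 +_) (upTo (length ds))     ≡⟨ map-cong (+-comm 4) (upTo (length ds)) ⟩
    map (_+ 4) (upTo (length ds))     ∎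

-- Upper bound

blocks⁺ : ∀ {C₁ C₂ C₃ C₄ q₁ q₂ q₃ q₄ : List ℕ} → C₁ ⊆ q₁ → C₂ ⊆ q₂ → C₃ ⊆ q₃ → C₄ ⊆ q₄ →
          C₁ ++ C₂ ++ C₃ ++ C₄ ⊆ concat (q₁ ∷ q₂ ∷ q₃ ∷ q₄ ∷ [])
blocks⁺ s₁ s₂ s₃ s₄ = ++⁺ s₁ (++⁺ s₂ (++⁺ s₃ (++⁺ʳ [] s₄)))

singleton⊆ : ∀ {x q} {ys : List ℕ} → x ∷ [] ⊆ ys → Monotone q ys → x ∷ [] ⊆ q
singleton⊆ x⊆ys = Sum.[ id , id ]′ ∘ Monotone-resp-⊇ x⊆ys

-- The direction patterns in which q₂ reverses ys while q₄ keeps it, read along zs = reverse ys.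
contains-pattern12ʳ : ∀ {q₁ q₂ q₃ q₄} zs → Unique zs → 3 ≤ length zs → reverse zs ⊆ q₁ → zs ⊆ q₂ →
  Monotone q₃ zs → reverse zs ⊆ q₄ → Contains (concat (q₁ ∷ q₂ ∷ q₃ ∷ q₄ ∷ [])) (pattern12 (length zs))
contains-pattern12ʳ {q₁} (a ∷ b ∷ c ∷ ds) u _ _ s₂ (inj₁ s₃) r₄ = shape⊆⇒contains u (blocks⁺
  (minimum q₁)
  s₂
  (⊆-trans (refl ∷ refl ∷ c ∷ʳ ⊆-refl) s₃)
  (⊆-trans (reverse⁺ {as = b ∷ c ∷ []} {bs = a ∷ b ∷ c ∷ ds} (a ∷ʳ refl ∷ refl ∷ minimum ds)) r₄))
contains-pattern12ʳ (b ∷ c ∷ a ∷ es) u _ r₁ s₂ (inj₂ r₃) r₄ =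
  subst (Contains _) (cong (pattern12 ∘ (3 +_)) (length-reverse es))
    (shape⊆⇒contains u′ (⊆-trans (⊆-reflexive shape≡) (blocks⁺
      (⊆-trans (++⁺ˡ (reverse es) (refl ∷ c ∷ʳ refl ∷ [])) (unfold r₁))
      (⊆-trans (b ∷ʳ refl ∷ minimum _) s₂)
      (⊆-trans (++⁺ ⊆-refl (refl ∷ c ∷ʳ refl ∷ [])) (unfold r₃))
      (⊆-trans (++⁺ ⊆-refl (a ∷ʳ refl ∷ refl ∷ [])) (unfold r₄)))))
  where
  unfold : ∀ {q} → reverse (b ∷ c ∷ a ∷ es) ⊆ q → reverse es ++ a ∷ c ∷ b ∷ [] ⊆ q
  unfold = subst (_⊆ _) (ʳ++-defn es)
  u′ : Unique (a ∷ b ∷ c ∷ reverse es)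
  u′ = Unique-resp-↭ (↭-trans (prep b (swap c a ↭-refl)) (swap b a (prep c (↭-sym (↭-reverse es))))) u
  shape≡ : shape a b c (reverse es) ≡ (a ∷ b ∷ []) ++ (c ∷ []) ++ (reverse es ++ a ∷ b ∷ []) ++ (reverse es ++ c ∷ b ∷ [])
  shape≡ = cong (λ t → a ∷ b ∷ c ∷ t) (sym (++-assoc (reverse es) (a ∷ b ∷ []) _))
contains-pattern12ʳ (_ ∷ [])     _ (s≤s ())       _ _ _ _
contains-pattern12ʳ (_ ∷ _ ∷ []) _ (s≤s (s≤s ())) _ _ _ _

contains-pattern12 : ∀ {q₁ q₂ q₃ q₄} ys → Unique ys → 3 ≤ length ys → ys ⊆ q₁ →
  Monotone q₂ ys → Monotone q₃ ys → Monotone q₄ ys → Contains (concat (q₁ ∷ q₂ ∷ q₃ ∷ q₄ ∷ [])) (pattern12 (length ys))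
contains-pattern12 (a ∷ b ∷ c ∷ ds) u _ s₁ (inj₁ s₂) m₃ m₄ = shape⊆⇒contains u (blocks⁺
  s₁
  (⊆-trans (refl ∷ refl ∷ c ∷ʳ ⊆-refl) s₂)
  (singleton⊆ (a ∷ʳ b ∷ʳ refl ∷ minimum ds) m₃)
  (singleton⊆ (a ∷ʳ refl ∷ minimum _) m₄))
contains-pattern12 (a ∷ b ∷ c ∷ ds) u _ s₁ m₂@(inj₂ _) (inj₁ s₃) (inj₂ r₄) = shape⊆⇒contains u (blocks⁺
  s₁
  (singleton⊆ (refl ∷ minimum _) m₂)
  (⊆-trans (a ∷ʳ refl ∷ c ∷ʳ ⊆-refl) s₃)
  (⊆-trans (reverse⁺ {as = b ∷ c ∷ []} {bs = a ∷ b ∷ c ∷ ds} (a ∷ʳ refl ∷ refl ∷ minimum ds)) r₄))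
contains-pattern12 (a ∷ b ∷ c ∷ es) u _ s₁ (inj₂ r₂) m₃@(inj₂ _) (inj₂ r₄) =
  subst (Contains _) (cong (pattern12 ∘ (3 +_)) (length-reverse es))
    (shape⊆⇒contains u′ (⊆-trans (⊆-reflexive shape≡) (blocks⁺
      (⊆-trans (refl ∷ refl ∷ refl ∷ minimum es) s₁)
      (⊆-trans (++⁺ ⊆-refl (c ∷ʳ b ∷ʳ refl ∷ [])) (unfold r₂))
      (singleton⊆ (a ∷ʳ refl ∷ minimum _) m₃)
      (⊆-trans (++⁺ ⊆-refl (refl ∷ refl ∷ a ∷ʳ [])) (unfold r₄)))))
  where
  unfold : ∀ {q} → reverse (a ∷ b ∷ c ∷ es) ⊆ q → reverse es ++ c ∷ b ∷ a ∷ [] ⊆ q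
  unfold = subst (_⊆ _) (ʳ++-defn es)
  u′ : Unique (a ∷ b ∷ c ∷ reverse es)
  u′ = Unique-resp-↭ (prep a (prep b (prep c (↭-sym (↭-reverse es))))) u
  shape≡ : shape a b c (reverse es) ≡ (a ∷ b ∷ c ∷ []) ++ (reverse es ++ a ∷ []) ++ (b ∷ []) ++ (reverse es ++ c ∷ b ∷ [])
  shape≡ = cong (λ t → a ∷ b ∷ c ∷ t) (sym (++-assoc (reverse es) (a ∷ []) _))
contains-pattern12 ys u 3≤ s₁ (inj₂ r₂) m₃ (inj₁ s₄) =
  subst (Contains _) (cong pattern12 (length-reverse ys))
    (contains-pattern12ʳ (reverse ys) (Unique-reverse u) (subst (3 ≤_) (sym (length-reverse ys)) 3≤)
      (reverse²-⊆ ys s₁) r₂ (Monotone-reverse ys m₃) (reverse²-⊆ ys s₄))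
contains-pattern12 (_ ∷ [])     _ (s≤s ())       _ _ _ _
contains-pattern12 (_ ∷ _ ∷ []) _ (s≤s (s≤s ())) _ _ _ _

formation-contains-pattern12 : ∀ n → 3 ≤ n → ∀ w → IsFormation (esTower 3 n) 4 w → Contains w (pattern12 n)
formation-contains-pattern12 n 3≤n _
  (L , |L| , uL , q₁ ∷ q₂ ∷ q₃ ∷ q₄ ∷ [] , refl , q₁↭L ∷ q₂↭L ∷ q₃↭L ∷ q₄↭L ∷ [] , refl) =
  case monotone-sublist-all n (q₂ ∷ q₃ ∷ q₄ ∷ []) q₁ uq₁
         (All-∈-↭ q₁↭L q₂↭L ∷ All-∈-↭ q₁↭L q₃↭L ∷ All-∈-↭ q₁↭L q₄↭L ∷ []) (trans (↭-length q₁↭L) |L|) of λ where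
    (ys , ys⊆q₁ , len , m₂ ∷ m₃ ∷ m₄ ∷ []) → subst (Contains _) (cong pattern12 len)
      (contains-pattern12 ys (AllPairs-resp-⊇ ys⊆q₁ uq₁) (subst (3 ≤_) (sym len) 3≤n) ys⊆q₁ m₂ m₃ m₄)
  where
  uq₁ : Unique q₁
  uq₁ = Unique-resp-↭ (↭-sym q₁↭L) uL

-- Lower bound

Contains-resp-⊇ : ∀ {w u v} → v ⊆ u → Contains w u → Contains w v
Contains-resp-⊇ v⊆u (sub , sub⊆w , f , inj , refl) =
  let sub′ , sub′⊆sub , eq = ⊆-map⁻ f sub v⊆u in
  sub′ , ⊆-trans sub′⊆sub sub⊆w , f , (λ x∈ y∈ → inj (lookup sub′⊆sub x∈) (lookup sub′⊆sub y∈)) , eq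

ababb : ℕ → ℕ → List ℕ
ababb a b = a ∷ b ∷ a ∷ b ∷ b ∷ []

ababb⊆pattern12 : ∀ k → ababb 1 2 ⊆ pattern12 (3 + k)
ababb⊆pattern12 k = refl ∷ refl ∷ 3 ∷ʳ ++⁺ˡ _ (refl ∷ refl ∷ ++⁺ˡ _ (3 ∷ʳ refl ∷ []))

ababb-repeats : ∀ {y₁ y₂ y₃ y₄ y₅ a b : ℕ} → y₁ ∷ y₂ ∷ y₃ ∷ y₄ ∷ y₅ ∷ [] ≡ ababb a b →
                y₃ ≡ y₁ × y₄ ≡ y₂ × y₅ ≡ y₂
ababb-repeats refl = refl , refl , refl

contains-ababb : ∀ {w} → Contains w (ababb 1 2) → ∃₂ λ a b → ababb a b ⊆ w
contains-ababb (x₁ ∷ x₂ ∷ x₃ ∷ x₄ ∷ x₅ ∷ [] , sub⊆w , f , inj , eq)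
  with e₃ , e₄ , e₅ ← ababb-repeats eq
  with refl ← inj (there (there (here refl))) (here refl) e₃
  with refl ← inj (there (there (there (here refl)))) (there (here refl)) e₄
  with refl ← inj (there (there (there (there (here refl))))) (there (here refl)) e₅
  = x₁ , x₂ , sub⊆w

Increasing Decreasing : List ℕ → Set
Increasing = AllPairs _<_
Decreasing = AllPairs _>_

-- The only split of a b a b b into three repetition-free pieces is ab|ab|b, forcing both a < b and b < a.
ababb-split : ∀ {a b} k m → Increasing (take k (ababb a b)) → Decreasing (take m (drop k (ababb a b))) →
              Increasing (drop m (drop k (ababb a b))) → ⊥
ababb-split (suc (suc (suc k))) _ inc _ _                 = <-irrefl refl (AllPairs-repeat inc (there (here refl)))
ababb-split 2 0 _ _ (_ ∷ inc)                             = <-irrefl refl (AllPairs-repeat inc (here refl))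
ababb-split 2 1 _ _ inc                                   = <-irrefl refl (AllPairs-repeat inc (here refl))
ababb-split 2 (suc (suc m)) ((a<b ∷ _) ∷ _) ((b<a ∷ _) ∷ _) _ = <-asym a<b b<a
ababb-split 1 0 _ _ inc                                   = <-irrefl refl (AllPairs-repeat inc (there (here refl)))
ababb-split 1 1 _ _ (_ ∷ inc)                             = <-irrefl refl (AllPairs-repeat inc (here refl))
ababb-split 1 2 _ _ inc                                   = <-irrefl refl (AllPairs-repeat inc (here refl))
ababb-split 1 (suc (suc (suc m))) _ dec _                 = <-irrefl refl (AllPairs-repeat dec (there (here refl)))
ababb-split 0 0 _ _ inc                                   = <-irrefl refl (AllPairs-repeat inc (there (here refl)))
ababb-split 0 1 _ _ inc                                   = <-irrefl refl (AllPairs-repeat inc (there (here refl)))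
ababb-split 0 2 _ _ (_ ∷ inc)                             = <-irrefl refl (AllPairs-repeat inc (here refl))
ababb-split 0 (suc (suc (suc m))) _ dec _                 = <-irrefl refl (AllPairs-repeat dec (there (here refl)))

ababb⊈inc++dec++inc : ∀ {a b xs ys zs} → Increasing xs → Decreasing ys → Increasing zs → ¬ ababb a b ⊆ xs ++ ys ++ zs
ababb⊈inc++dec++inc {xs = xs} {ys} inc dec inc′ ababb⊆ =
  let k , s₁ , rest = ⊆-++⁻ xs ababb⊆
      m , s₂ , s₃   = ⊆-++⁻ ys rest
  in ababb-split k m (AllPairs-resp-⊇ s₁ inc) (AllPairs-resp-⊇ s₂ dec) (AllPairs-resp-⊇ s₃ inc′)

inc++dec++inc-avoids-pattern12 : ∀ k {xs ys zs} → Increasing xs → Decreasing ys → Increasing zs →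
  ¬ Contains (xs ++ ys ++ zs) (pattern12 (3 + k))
inc++dec++inc-avoids-pattern12 k inc dec inc′ contains =
  let a , b , ababb⊆ = contains-ababb (Contains-resp-⊇ (ababb⊆pattern12 k) contains)
  in ababb⊈inc++dec++inc inc dec inc′ ababb⊆

formation : ∀ r (ps : List (List ℕ)) → All (_↭ upTo r) ps → IsFormation r (length ps) (concat ps)
formation r ps ps↭ = upTo r , length-upTo r , upTo⁺ r , ps , refl , ps↭ , refl

upTo-increasing : ∀ r → Increasing (upTo r)
upTo-increasing r = applyUpTo⁺₁ id r (λ i<j _ → i<j)

downFrom-decreasing : ∀ r → Decreasing (downFrom r)
downFrom-decreasing r = applyDownFrom⁺₁ id r (λ j<i _ → j<i)

downFrom↭upTo : ∀ r → downFrom r ↭ upTo r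
downFrom↭upTo r = subst (_↭ upTo r) (reverse-upTo r) (↭-reverse (upTo r))

not-forces-pattern12 : ∀ k s → s < 4 → ¬ Forces s (pattern12 (3 + k))
not-forces-pattern12 k 0 _ (r , forces) =
  inc++dec++inc-avoids-pattern12 k {[]} {[]} {[]} [] [] [] (forces _ (formation r [] []))
not-forces-pattern12 k 1 _ (r , forces) =
  inc++dec++inc-avoids-pattern12 k {upTo r} {[]} {[]} (upTo-increasing r) [] []
    (forces _ (formation r (upTo r ∷ []) (↭-refl ∷ [])))
not-forces-pattern12 k 2 _ (r , forces) =
  inc++dec++inc-avoids-pattern12 k {upTo r} {downFrom r} {[]} (upTo-increasing r) (downFrom-decreasing r) []
    (forces _ (formation r (upTo r ∷ downFrom r ∷ []) (↭-refl ∷ downFrom↭upTo r ∷ [])))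
not-forces-pattern12 k 3 _ (r , forces) =
  inc++dec++inc-avoids-pattern12 k {upTo r} {downFrom r} {upTo r ++ []} (upTo-increasing r) (downFrom-decreasing r)
    (subst Increasing (sym (++-identityʳ (upTo r))) (upTo-increasing r))
    (forces _ (formation r (upTo r ∷ downFrom r ∷ upTo r ∷ []) (↭-refl ∷ downFrom↭upTo r ∷ ↭-refl ∷ [])))
not-forces-pattern12 k (suc (suc (suc (suc _)))) (s≤s (s≤s (s≤s (s≤s ()))))

formationWidth-pattern12 : ∀ k → FormationWidth (pattern12 (3 + k)) 4
formationWidth-pattern12 k =
  (esTower 3 (3 + k) , formation-contains-pattern12 (3 + k) (m≤m+n 3 k)) , not-forces-pattern12 k

lemma12 : ∀ (n : ℕ) → 4 ≤ n → FormationWidth (pattern12 n) 4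
lemma12 n 4≤n with k , refl ← m≤n⇒∃[o]m+o≡n (<⇒≤ 4≤n) = formationWidth-pattern12 k
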